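{- Let $H$ be a marked hypergraph and $X$ a subhypergraph of $H$. Then $\tau_M(H)\le\tau_M(X)$. In particular, if $X$ is a Maker win then $H$ is a Maker win.
   Context: A marked hypergraph $H$: finite nonempty $V(H)$, edge set $E(H)$ of nonempty subsets of $V(H)$, marked set $M(H)\subseteq V(H)$. Subhypergraph $X$: $V(X)\subseteq V(H)$, $E(X)\subseteq E(H)$, $M(X)=V(X)\cap M(H)$. $H^{+x}$ marks non-marked $x$; $H^{ -y}$ deletes $y$ and all edges containing it. Trivial Maker win: some edge $e$ with $|e\setminus M(H)|\le1$. Maker win (recursive): if $|V(H)\setminus M(H)|\le1$, iff trivial Maker win; otherwise iff some non-marked $x$ has $H^{+x-y}$ a Maker win for all non-marked $y\ne x$. $\tau_M(H)$: if $H$ is a trivial Maker win, $\tau_M(H)=\min_{e\in E(H)}|e\setminus M(H)|$; if $H$ is not a trivial Maker win and $|V(H)\setminus M(H)|\le1$, $\tau_M(H)=\infty$; otherwise $\tau_M(H)=1+\min_{x\in V(H)\setminus M(H)}\max_{y\in V(H)\setminus(M(H)\cup\{x\})}\tau_M(H^{+x-y})$. (It is finite iff $H$ is a Maker win.) -}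

module Defs where

open import Data.Bool using (Bool; true; false; _∧_; not; if_then_else_)
open import Data.Nat using (ℕ; zero; suc; _≤_; _<_; _≤ᵇ_; _⊔_; _⊓_)
open import Data.Fin using (Fin)
open import Data.Fin.Subset using (Subset; _∈_; _∉_; _⊆_; _∪_; _∩_; _─_; _-_; ⁅_⁆; ∣_∣; Nonempty)
open import Data.List using (List; []; _∷_; filterᵇ; foldr; map; allFin)
open import Data.Bool.ListAction using (any)
import Data.List.Membership.Propositional as LM
open import Data.Vec using (lookup)
open import Data.Product using (Σ; _×_; _,_)
open import Data.Sum using (_⊎_)
open import Data.Empty using (⊥)
open import Relation.Nullary using (¬_)
open import Relation.Binary.PropositionalEquality using (_≡_)
open import Relation.Nullary.Decidable using (does)
open import Data.Fin using (_≟_)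

-- Marked hypergraphs whose vertices are drawn from the finite type Fin n.
-- V : vertex set, E : edges (a finite list of subsets; duplicates are harmless),
-- M : marked set.
record MHyp (n : ℕ) : Set where
  constructor mhyp
  field
    V : Subset n
    E : List (Subset n)
    M : Subset n
open MHyp public

record WellFormed {n : ℕ} (H : MHyp n) : Set where
  field
    V-nonempty : Nonempty (V H)
    E-nonempty : ∀ e → e LM.∈ E H → Nonempty e
    E-⊆V       : ∀ e → e LM.∈ E H → e ⊆ V H
    M-⊆V       : M H ⊆ V H

record IsSub {n : ℕ} (X H : MHyp n) : Set where
  field
    V-⊆ : V X ⊆ V H
    E-⊆ : ∀ e → e LM.∈ E X → e LM.∈ E H
    M-≡ : M X ≡ V X ∩ M H

_⁺_ : ∀ {n} → MHyp n → Fin n → MHyp n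
H ⁺ x = mhyp (V H) (E H) (M H ∪ ⁅ x ⁆)

_⁻_ : ∀ {n} → MHyp n → Fin n → MHyp n
H ⁻ y = mhyp (V H - y) (filterᵇ (λ e → not (lookup e y)) (E H)) (M H - y)

unmarkedCount : ∀ {n} → MHyp n → ℕ
unmarkedCount H = ∣ V H ─ M H ∣

unmarked : ∀ {n} → MHyp n → List (Fin n)
unmarked {n} H = filterᵇ (λ x → lookup (V H) x ∧ not (lookup (M H) x)) (allFin n)

TrivialWin : ∀ {n} → MHyp n → Set
TrivialWin H = Σ _ λ e → e LM.∈ E H × ∣ e ─ M H ∣ ≤ 1

trivialWin? : ∀ {n} → MHyp n → Bool
trivialWin? H = any (λ e → ∣ e ─ M H ∣ ≤ᵇ 1) (E H)

-- Maker win, with a fuel argument for termination.  Each recursive step removes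
-- exactly two non-marked vertices, so fuel = unmarkedCount H is always sufficient.
mutual
  MakerWinF : ∀ {n} → ℕ → MHyp n → Set
  MakerWinF fuel H = (unmarkedCount H ≤ 1 × TrivialWin H)
                   ⊎ (1 < unmarkedCount H × StepWin fuel H)

  StepWin : ∀ {n} → ℕ → MHyp n → Set
  StepWin zero H = ⊥
  StepWin (suc k) H =
    Σ _ λ x → x ∈ V H × x ∉ M H ×
      (∀ y → y ∈ V H → y ∉ M H → ¬ (y ≡ x) → MakerWinF k ((H ⁺ x) ⁻ y))

MakerWin : ∀ {n} → MHyp n → Set
MakerWin H = MakerWinF (unmarkedCount H) H

data ℕ∞ : Set where
  fin : ℕ → ℕ∞
  ∞   : ℕ∞

data _≤∞_ : ℕ∞ → ℕ∞ → Set where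
  fin≤fin : ∀ {a b} → a ≤ b → fin a ≤∞ fin b
  _≤∞∞    : ∀ a → a ≤∞ ∞

min∞ : ℕ∞ → ℕ∞ → ℕ∞
min∞ (fin a) (fin b) = fin (a ⊓ b)
min∞ (fin a) ∞ = fin a
min∞ ∞ b = b

max∞ : ℕ∞ → ℕ∞ → ℕ∞
max∞ (fin a) (fin b) = fin (a ⊔ b)
max∞ (fin a) ∞ = ∞
max∞ ∞ b = ∞

suc∞ : ℕ∞ → ℕ∞
suc∞ (fin a) = fin (suc a)
suc∞ ∞ = ∞

-- minimum / maximum over a list (min of empty = ∞, max of empty = 0)
minimum∞ : List ℕ∞ → ℕ∞
minimum∞ = foldr min∞ ∞

maximum∞ : List ℕ∞ → ℕ∞
maximum∞ = foldr max∞ (fin 0)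

τF : ∀ {n} → ℕ → MHyp n → ℕ∞
τF fuel H =
  if trivialWin? H
  then minimum∞ (map (λ e → fin ∣ e ─ M H ∣) (E H))
  else (if unmarkedCount H ≤ᵇ 1 then ∞ else step fuel)
  where
    step : ℕ → ℕ∞
    step zero = ∞
    step (suc k) = suc∞ (minimum∞ (map (λ x →
                     maximum∞ (map (λ y → τF k ((H ⁺ x) ⁻ y))
                       (filterᵇ (λ y → not (does (y ≟ x))) (unmarked H))))
                     (unmarked H)))

τM : ∀ {n} → MHyp n → ℕ∞
τM H = τF (unmarkedCount H) H

-- Maker wins in H by following a winning strategy for X move for move.  If Breaker answers
-- Maker's x with a vertex y of X, the new position (X⁺x)⁻y is again a subhypergraph of
-- (H⁺x)⁻y.  If y lies outside X, Maker pretends that Breaker deleted some other free vertex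
-- y′ of X instead: (X⁺x)⁻y′ ⊑ X⁺x ⊑ (H⁺x)⁻y.  Trivial wins pass from X to H because an edge
-- has no more unmarked vertices in H than in X, so induction on the number of unmarked
-- vertices compares the two games position by position.
module Submission where

open import Defs
open import Data.Bool using (true; false; not; T)
open import Data.Bool.Properties using (T-≡; T-∧)
open import Data.Fin using (Fin; _≟_)
open import Data.Fin.Subset using (Subset; inside; _∈_; _∉_; _⊆_; _─_; _-_; ⁅_⁆; ∣_∣; Nonempty)
open import Data.Fin.Subset.Properties
  using (_∈?_; nonempty?; Empty-unique; ∣⊥∣≡0; ∣⁅x⁆∣≡1; x∈⁅x⁆; x∈⁅y⁆⇒x≡y; x∉⁅y⁆⇒x≢y;
         p⊆q⇒∣p∣≤∣q∣; x∈p∪q⁺; x∈p∪q⁻; x∈p∩q⁺; x∈p∩q⁻; x∈p∧x∉q⇒x∈p─q; p─q⊆p;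
         x∈p∧x≢y⇒x∈p-y; x∈p⇒∣p-x∣<∣p∣)
open import Data.List using (List; []; _∷_; filterᵇ; map; allFin)
import Data.List.Membership.Propositional as List
open import Data.List.Membership.Propositional using (find; lose)
open import Data.List.Membership.Propositional.Properties using (∈-filter⁺; ∈-filter⁻; ∈-allFin)
open import Data.List.Relation.Unary.Any using (here; there)
open import Data.List.Relation.Unary.Any.Properties using (any⁺; any⁻)
open import Data.Nat using (ℕ; zero; suc; _≤_; _<_; _≤ᵇ_; _≤?_; z≤n; s≤s)
open import Data.Nat.Properties
  using (≤-refl; ≤-trans; ≤-<-trans; <-≤-trans; <⇒≤; <⇒≢; <⇒≱; ≰⇒>; ≤-pred; n≤1+n; ≤ᵇ⇒≤; ≤⇒≤ᵇ;
         m⊓n≤m; m⊓n≤n; ⊓-glb; m≤m⊔n; m≤n⊔m; ⊔-lub)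
open import Data.Product using (∃; _×_; _,_; proj₁; proj₂)
open import Data.Sum using (inj₁; inj₂)
open import Data.Vec using (_∷_; lookup)
import Data.Vec as Vec
open import Data.Vec.Properties using ([]=⇒lookup; lookup⇒[]=)
open import Data.Unit using (tt)
open import Function using (_∘_)
open import Function.Bundles using (Equivalence)
open import Relation.Binary.PropositionalEquality using (_≡_; _≢_; refl; sym; trans; cong; subst)
open import Relation.Nullary using (¬_; Dec; yes; no; contradiction)
open import Relation.Nullary.Decidable using (does; map′; T?; dec-true; dec-false)

private
  variable
    n k kh : ℕ
    p q r : Subset n
    x y : Fin n
    H X Y : MHyp n

x∈p─q⇒x∉q : ∀ (p q : Subset n) → x ∈ p ─ q → x ∉ q
x∈p─q⇒x∉q (_ ∷ p) (inside ∷ q) () Vec.here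
x∈p─q⇒x∉q (_ ∷ p) (_ ∷ q) (Vec.there x∈) (Vec.there x∈q) = x∈p─q⇒x∉q p q x∈ x∈q

x∈p─q⁻ : x ∈ p ─ q → x ∈ p × x ∉ q
x∈p─q⁻ {p = p} {q = q} x∈ = p─q⊆p p q x∈ , x∈p─q⇒x∉q p q x∈

x∈p-y⁻ : x ∈ p - y → x ∈ p × x ≢ y
x∈p-y⁻ x∈ with x∈p─q⁻ x∈
... | x∈p , x∉⁅y⁆ = x∈p , x∉⁅y⁆⇒x≢y x∉⁅y⁆

─-anti : ∀ p → q ⊆ r → p ─ r ⊆ p ─ q
─-anti _ q⊆r x∈ with x∈p─q⁻ x∈
... | x∈p , x∉r = x∈p∧x∉q⇒x∈p─q x∈p (x∉r ∘ q⊆r)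

p⊆q⇒p-y⊆q-y : p ⊆ q → p - y ⊆ q - y
p⊆q⇒p-y⊆q-y p⊆q x∈ with x∈p-y⁻ x∈
... | x∈p , x≢y = x∈p∧x≢y⇒x∈p-y (p⊆q x∈p) x≢y

0<∣p∣⇒Nonempty : 0 < ∣ p ∣ → Nonempty p
0<∣p∣⇒Nonempty {n} {p} 0<∣p∣ with nonempty? p
... | yes ne = ne
... | no ¬ne = contradiction (trans (cong ∣_∣ (Empty-unique ¬ne)) (∣⊥∣≡0 n)) (<⇒≢ 0<∣p∣ ∘ sym)

x∈p⇒0<∣p∣ : x ∈ p → 0 < ∣ p ∣
x∈p⇒0<∣p∣ x∈p = ≤-<-trans z≤n (x∈p⇒∣p-x∣<∣p∣ x∈p)

x,y∈p∧y≢x⇒1<∣p∣ : x ∈ p → y ∈ p → y ≢ x → 1 < ∣ p ∣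
x,y∈p∧y≢x⇒1<∣p∣ x∈p y∈p y≢x = ≤-<-trans (x∈p⇒0<∣p∣ (x∈p∧x≢y⇒x∈p-y y∈p y≢x)) (x∈p⇒∣p-x∣<∣p∣ x∈p)

∣p∣≤1∧x∈p⇒p⊆⁅x⁆ : ∣ p ∣ ≤ 1 → x ∈ p → p ⊆ ⁅ x ⁆
∣p∣≤1∧x∈p⇒p⊆⁅x⁆ {x = x} ∣p∣≤1 x∈p {y} y∈p with y ≟ x
... | yes refl = x∈⁅x⁆ x
... | no y≢x = contradiction ∣p∣≤1 (<⇒≱ (x,y∈p∧y≢x⇒1<∣p∣ x∈p y∈p y≢x))

1<∣p∣⇒∃≢ : 1 < ∣ p ∣ → (x : Fin n) → ∃ λ y → y ∈ p × y ≢ x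
1<∣p∣⇒∃≢ {p = p} 1<∣p∣ x with nonempty? (p - x)
... | yes (y , y∈) = y , x∈p-y⁻ y∈
... | no ¬ne = contradiction (subst (∣ p ∣ ≤_) (∣⁅x⁆∣≡1 x) (p⊆q⇒∣p∣≤∣q∣ p⊆⁅x⁆)) (<⇒≱ 1<∣p∣)
  where
  p⊆⁅x⁆ : p ⊆ ⁅ x ⁆
  p⊆⁅x⁆ {y} y∈p with y ≟ x
  ... | yes refl = x∈⁅x⁆ x
  ... | no y≢x = contradiction (y , x∈p∧x≢y⇒x∈p-y y∈p y≢x) ¬ne

∣p∣≤1⇒⊆⁅x⁆ : p ⊆ q → ∣ p ∣ ≤ 1 → Nonempty q → ∃ λ x → x ∈ q × p ⊆ ⁅ x ⁆
∣p∣≤1⇒⊆⁅x⁆ {p = p} p⊆q ∣p∣≤1 (z , z∈q) with nonempty? p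
... | yes (x , x∈p) = x , p⊆q x∈p , ∣p∣≤1∧x∈p⇒p⊆⁅x⁆ ∣p∣≤1 x∈p
... | no ¬ne = z , z∈q , λ y∈p → contradiction (_ , y∈p) ¬ne

≤∞-refl : ∀ {u} → u ≤∞ u
≤∞-refl {fin a} = fin≤fin ≤-refl
≤∞-refl {∞} = ∞ ≤∞∞

≤∞-trans : ∀ {u v w} → u ≤∞ v → v ≤∞ w → u ≤∞ w
≤∞-trans (fin≤fin a≤b) (fin≤fin b≤c) = fin≤fin (≤-trans a≤b b≤c)
≤∞-trans _ (_ ≤∞∞) = _ ≤∞∞

min∞≤ˡ : ∀ u v → min∞ u v ≤∞ u
min∞≤ˡ (fin a) (fin b) = fin≤fin (m⊓n≤m a b)
min∞≤ˡ (fin a) ∞ = ≤∞-refl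
min∞≤ˡ ∞ v = _ ≤∞∞

min∞≤ʳ : ∀ u v → min∞ u v ≤∞ v
min∞≤ʳ (fin a) (fin b) = fin≤fin (m⊓n≤n a b)
min∞≤ʳ (fin a) ∞ = _ ≤∞∞
min∞≤ʳ ∞ v = ≤∞-refl

min∞-glb : ∀ {w u v} → w ≤∞ u → w ≤∞ v → w ≤∞ min∞ u v
min∞-glb (fin≤fin c≤a) (fin≤fin c≤b) = fin≤fin (⊓-glb c≤a c≤b)
min∞-glb {u = fin a} w≤u (_ ≤∞∞) = w≤u
min∞-glb {u = ∞} _ w≤v = w≤v

≤max∞ˡ : ∀ u v → u ≤∞ max∞ u v
≤max∞ˡ (fin a) (fin b) = fin≤fin (m≤m⊔n a b)
≤max∞ˡ (fin a) ∞ = _ ≤∞∞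
≤max∞ˡ ∞ v = _ ≤∞∞

≤max∞ʳ : ∀ u v → v ≤∞ max∞ u v
≤max∞ʳ (fin a) (fin b) = fin≤fin (m≤n⊔m a b)
≤max∞ʳ (fin a) ∞ = _ ≤∞∞
≤max∞ʳ ∞ v = _ ≤∞∞

max∞-lub : ∀ {w u v} → u ≤∞ w → v ≤∞ w → max∞ u v ≤∞ w
max∞-lub (fin≤fin a≤c) (fin≤fin b≤c) = fin≤fin (⊔-lub a≤c b≤c)
max∞-lub {u = fin a} {fin b} _ (_ ≤∞∞) = _ ≤∞∞
max∞-lub {u = fin a} {∞} _ v≤w = v≤w
max∞-lub {u = ∞} u≤w _ = u≤w

suc∞-mono : ∀ {u v} → u ≤∞ v → suc∞ u ≤∞ suc∞ v
suc∞-mono (fin≤fin a≤b) = fin≤fin (s≤s a≤b)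
suc∞-mono (fin a ≤∞∞) = _ ≤∞∞
suc∞-mono (∞ ≤∞∞) = _ ≤∞∞

1≤suc∞ : ∀ u → fin 1 ≤∞ suc∞ u
1≤suc∞ (fin a) = fin≤fin (s≤s z≤n)
1≤suc∞ ∞ = _ ≤∞∞

module _ {A : Set} where

  minimum∞≤ : ∀ (f : A → ℕ∞) {xs a} → a List.∈ xs → minimum∞ (map f xs) ≤∞ f a
  minimum∞≤ f {b ∷ xs} (here refl) = min∞≤ˡ (f b) _
  minimum∞≤ f {b ∷ xs} (there a∈) = ≤∞-trans (min∞≤ʳ (f b) _) (minimum∞≤ f a∈)

  minimum∞-glb : ∀ (f : A → ℕ∞) xs {w} → (∀ {a} → a List.∈ xs → w ≤∞ f a) → w ≤∞ minimum∞ (map f xs)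
  minimum∞-glb f [] _ = _ ≤∞∞
  minimum∞-glb f (a ∷ xs) w≤f = min∞-glb (w≤f (here refl)) (minimum∞-glb f xs (w≤f ∘ there))

  ≤maximum∞ : ∀ (f : A → ℕ∞) {xs a} → a List.∈ xs → f a ≤∞ maximum∞ (map f xs)
  ≤maximum∞ f {b ∷ xs} (here refl) = ≤max∞ˡ (f b) _
  ≤maximum∞ f {b ∷ xs} (there a∈) = ≤∞-trans (≤maximum∞ f a∈) (≤max∞ʳ (f b) _)

  maximum∞-lub : ∀ (f : A → ℕ∞) xs {w} → (∀ {a} → a List.∈ xs → f a ≤∞ w) → maximum∞ (map f xs) ≤∞ w
  maximum∞-lub f [] {fin c} _ = fin≤fin z≤n
  maximum∞-lub f [] {∞} _ = _ ≤∞∞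
  maximum∞-lub f (a ∷ xs) f≤w = max∞-lub (f≤w (here refl)) (maximum∞-lub f xs (f≤w ∘ there))

  minimum∞-map-≤ : ∀ (f g : A → ℕ∞) xs ys →
                   (∀ {a} → a List.∈ xs → ∃ λ b → b List.∈ ys × g b ≤∞ f a) →
                   minimum∞ (map g ys) ≤∞ minimum∞ (map f xs)
  minimum∞-map-≤ f g xs ys dominated = minimum∞-glb f xs λ a∈ →
    let b , b∈ , gb≤fa = dominated a∈ in ≤∞-trans (minimum∞≤ g b∈) gb≤fa

  maximum∞-map-≤ : ∀ (f g : A → ℕ∞) xs ys →
                   (∀ {b} → b List.∈ ys → ∃ λ a → a List.∈ xs × g b ≤∞ f a) →
                   maximum∞ (map g ys) ≤∞ maximum∞ (map f xs)
  maximum∞-map-≤ f g xs ys dominated = maximum∞-lub g ys λ b∈ →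
    let a , a∈ , gb≤fa = dominated b∈ in ≤∞-trans gb≤fa (≤maximum∞ f a∈)

∈⇒T-lookup : x ∈ p → T (lookup p x)
∈⇒T-lookup x∈p = Equivalence.from T-≡ ([]=⇒lookup x∈p)

T-lookup⇒∈ : T (lookup p x) → x ∈ p
T-lookup⇒∈ {p = p} {x = x} t = lookup⇒[]= x p (Equivalence.to T-≡ t)

∉⇒T-not-lookup : x ∉ p → T (not (lookup p x))
∉⇒T-not-lookup {n} {x} {p} x∉p with lookup p x in eq
... | true = x∉p (lookup⇒[]= x p eq)
... | false = tt

T-not-lookup⇒∉ : T (not (lookup p x)) → x ∉ p
T-not-lookup⇒∉ t x∈p = subst (T ∘ not) ([]=⇒lookup x∈p) t

unmarkedSet : MHyp n → Subset n
unmarkedSet H = V H ─ M H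

∈-unmarked⁺ : x ∈ unmarkedSet H → x List.∈ unmarked H
∈-unmarked⁺ {x = x} x∈ with x∈p─q⁻ x∈
... | x∈V , x∉M = ∈-filter⁺ (T? ∘ _) (∈-allFin x)
                         (Equivalence.from T-∧ (∈⇒T-lookup x∈V , ∉⇒T-not-lookup x∉M))

∈-unmarked⁻ : x List.∈ unmarked H → x ∈ unmarkedSet H
∈-unmarked⁻ {n} {H = H} x∈ with ∈-filter⁻ (T? ∘ _) {xs = allFin n} x∈
... | _ , t with Equivalence.to T-∧ t
... | t-V , t-M = x∈p∧x∉q⇒x∈p─q (T-lookup⇒∈ t-V) (T-not-lookup⇒∉ t-M)

others : Fin n → List (Fin n) → List (Fin n)
others x = filterᵇ (λ y → not (does (y ≟ x)))

∈-others⁺ : ∀ {xs} → y List.∈ xs → y ≢ x → y List.∈ others x xs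
∈-others⁺ {y = y} {x} y∈ y≢x = ∈-filter⁺ (T? ∘ _) y∈ distinct
  where
  distinct : T (not (does (y ≟ x)))
  distinct with y ≟ x
  ... | yes y≡x = y≢x y≡x
  ... | no _ = tt

∈-others⁻ : ∀ {xs} → y List.∈ others x xs → y List.∈ xs × y ≢ x
∈-others⁻ {y = y} {x} {xs} y∈ with ∈-filter⁻ (T? ∘ _) {xs = xs} y∈
... | y∈xs , distinct with y ≟ x
... | no y≢x = y∈xs , y≢x

edge-⁻⁺ : ∀ {e} → e List.∈ E H → y ∉ e → e List.∈ E (H ⁻ y)
edge-⁻⁺ e∈ y∉e = ∈-filter⁺ (T? ∘ _) e∈ (∉⇒T-not-lookup y∉e)

edge-⁻⁻ : ∀ {e} → e List.∈ E (H ⁻ y) → e List.∈ E H × y ∉ e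
edge-⁻⁻ {H = H} e∈ with ∈-filter⁻ (T? ∘ _) {xs = E H} e∈
... | e∈H , t = e∈H , T-not-lookup⇒∉ t

trivialWin-dec : (H : MHyp n) → Dec (TrivialWin H)
trivialWin-dec H = map′ sound complete (T? (trivialWin? H))
  where
  sound : T (trivialWin? H) → TrivialWin H
  sound t with find (any⁻ _ (E H) t)
  ... | e , e∈ , gap≤1 = e , e∈ , ≤ᵇ⇒≤ _ 1 gap≤1
  complete : TrivialWin H → T (trivialWin? H)
  complete (e , e∈ , gap≤1) = any⁺ _ (lose e∈ (≤⇒≤ᵇ gap≤1))

minEdgeGap : MHyp n → ℕ∞
minEdgeGap H = minimum∞ (map (λ e → fin ∣ e ─ M H ∣) (E H))

replyValue : ℕ → MHyp n → Fin n → ℕ∞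
replyValue k H x = maximum∞ (map (λ y → τF k ((H ⁺ x) ⁻ y)) (others x (unmarked H)))

trivialWin?≡true : TrivialWin H → trivialWin? H ≡ true
trivialWin?≡true {H = H} = dec-true (trivialWin-dec H)

trivialWin?≡false : ¬ TrivialWin H → trivialWin? H ≡ false
trivialWin?≡false {H = H} = dec-false (trivialWin-dec H)

τF-trivial : TrivialWin H → τF k H ≡ minEdgeGap H
τF-trivial {H = H} tw rewrite trivialWin?≡true {H = H} tw = refl

τF-stuck : ¬ TrivialWin H → unmarkedCount H ≤ 1 → τF k H ≡ ∞
τF-stuck {H = H} ¬tw few
  rewrite trivialWin?≡false {H = H} ¬tw | dec-true (unmarkedCount H ≤? 1) few = refl

τF-step : ¬ TrivialWin H → 1 < unmarkedCount H →
          τF (suc k) H ≡ suc∞ (minimum∞ (map (replyValue k H) (unmarked H)))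
τF-step {H = H} ¬tw many
  rewrite trivialWin?≡false {H = H} ¬tw | dec-false (unmarkedCount H ≤? 1) (<⇒≱ many) = refl

1≤τF-nontrivial : ¬ TrivialWin H → fin 1 ≤∞ τF k H
1≤τF-nontrivial {H = H} {zero} ¬tw rewrite trivialWin?≡false {H = H} ¬tw with unmarkedCount H ≤ᵇ 1
... | true = _ ≤∞∞
... | false = _ ≤∞∞
1≤τF-nontrivial {H = H} {suc k} ¬tw with unmarkedCount H ≤? 1
... | yes few = subst (fin 1 ≤∞_) (sym (τF-stuck {H = H} {suc k} ¬tw few)) (_ ≤∞∞)
... | no many = subst (fin 1 ≤∞_) (sym (τF-step {H = H} {k} ¬tw (≰⇒> many))) (1≤suc∞ _)

record Proper (H : MHyp n) : Set where
  field
    edge-⊆V : ∀ {e} → e List.∈ E H → e ⊆ V H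
    M-⊆V : M H ⊆ V H
open Proper

WellFormed⇒Proper : WellFormed H → Proper H
WellFormed⇒Proper wf .edge-⊆V = WellFormed.E-⊆V wf _
WellFormed⇒Proper wf .M-⊆V = WellFormed.M-⊆V wf

Proper-⁺ : x ∈ V H → Proper H → Proper (H ⁺ x)
Proper-⁺ x∈V pH .edge-⊆V = pH .edge-⊆V
Proper-⁺ x∈V pH .M-⊆V i∈ with x∈p∪q⁻ _ _ i∈
... | inj₁ i∈M = pH .M-⊆V i∈M
... | inj₂ i∈⁅x⁆ rewrite x∈⁅y⁆⇒x≡y _ i∈⁅x⁆ = x∈V

Proper-⁻ : Proper H → Proper (H ⁻ y)
Proper-⁻ {H = H} pH .edge-⊆V e∈ i∈e with edge-⁻⁻ {H = H} e∈
... | e∈H , y∉e = x∈p∧x≢y⇒x∈p-y (pH .edge-⊆V e∈H i∈e) λ { refl → y∉e i∈e }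
Proper-⁻ pH .M-⊆V = p⊆q⇒p-y⊆q-y (pH .M-⊆V)

-- The subhypergraph relation, with M(X) = V(X) ∩ M(H) split into two inclusions.
infix 4 _⊑_

record _⊑_ (X H : MHyp n) : Set where
  field
    V-⊆ : V X ⊆ V H
    E-⊆ : ∀ {e} → e List.∈ E X → e List.∈ E H
    M-⊆ : M X ⊆ M H
    M-⊇ : ∀ {i} → i ∈ V X → i ∈ M H → i ∈ M X
open _⊑_

IsSub⇒⊑ : IsSub X H → X ⊑ H
IsSub⇒⊑ X⊆H .V-⊆ = IsSub.V-⊆ X⊆H
IsSub⇒⊑ X⊆H .E-⊆ = IsSub.E-⊆ X⊆H _
IsSub⇒⊑ {X = X} {H} X⊆H .M-⊆ i∈ = proj₂ (x∈p∩q⁻ (V X) (M H) (subst (_ ∈_) (IsSub.M-≡ X⊆H) i∈))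
IsSub⇒⊑ X⊆H .M-⊇ i∈V i∈M = subst (_ ∈_) (sym (IsSub.M-≡ X⊆H)) (x∈p∩q⁺ (i∈V , i∈M))

⊑-trans : X ⊑ Y → Y ⊑ H → X ⊑ H
⊑-trans X⊑Y Y⊑H .V-⊆ = Y⊑H .V-⊆ ∘ X⊑Y .V-⊆
⊑-trans X⊑Y Y⊑H .E-⊆ = Y⊑H .E-⊆ ∘ X⊑Y .E-⊆
⊑-trans X⊑Y Y⊑H .M-⊆ = Y⊑H .M-⊆ ∘ X⊑Y .M-⊆
⊑-trans X⊑Y Y⊑H .M-⊇ i∈V i∈M = X⊑Y .M-⊇ i∈V (Y⊑H .M-⊇ (X⊑Y .V-⊆ i∈V) i∈M)

⁻-⊑ : H ⁻ y ⊑ H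
⁻-⊑ .V-⊆ = proj₁ ∘ x∈p-y⁻
⁻-⊑ {H = H} .E-⊆ = proj₁ ∘ edge-⁻⁻ {H = H}
⁻-⊑ .M-⊆ = proj₁ ∘ x∈p-y⁻
⁻-⊑ .M-⊇ i∈V i∈M = x∈p∧x≢y⇒x∈p-y i∈M (proj₂ (x∈p-y⁻ i∈V))

⊑-⁺ : X ⊑ H → X ⁺ x ⊑ H ⁺ x
⊑-⁺ X⊑H .V-⊆ = X⊑H .V-⊆
⊑-⁺ X⊑H .E-⊆ = X⊑H .E-⊆
⊑-⁺ X⊑H .M-⊆ i∈ with x∈p∪q⁻ _ _ i∈
... | inj₁ i∈M = x∈p∪q⁺ (inj₁ (X⊑H .M-⊆ i∈M))
... | inj₂ i∈⁅x⁆ = x∈p∪q⁺ (inj₂ i∈⁅x⁆)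
⊑-⁺ X⊑H .M-⊇ i∈V i∈ with x∈p∪q⁻ _ _ i∈
... | inj₁ i∈M = x∈p∪q⁺ (inj₁ (X⊑H .M-⊇ i∈V i∈M))
... | inj₂ i∈⁅x⁆ = x∈p∪q⁺ (inj₂ i∈⁅x⁆)

⊑-⁻ : X ⊑ H → X ⁻ y ⊑ H ⁻ y
⊑-⁻ X⊑H .V-⊆ = p⊆q⇒p-y⊆q-y (X⊑H .V-⊆)
⊑-⁻ {X = X} {H} X⊑H .E-⊆ e∈ with edge-⁻⁻ {H = X} e∈
... | e∈X , y∉e = edge-⁻⁺ {H = H} (X⊑H .E-⊆ e∈X) y∉e
⊑-⁻ X⊑H .M-⊆ = p⊆q⇒p-y⊆q-y (X⊑H .M-⊆)
⊑-⁻ X⊑H .M-⊇ i∈V i∈M with x∈p-y⁻ i∈V | x∈p-y⁻ i∈M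
... | i∈VX , i≢y | i∈MH , _ = x∈p∧x≢y⇒x∈p-y (X⊑H .M-⊇ i∈VX i∈MH) i≢y

⊑-⁻-outside : Proper X → y ∉ V X → X ⊑ H → X ⊑ H ⁻ y
⊑-⁻-outside pX y∉V X⊑H .V-⊆ i∈V = x∈p∧x≢y⇒x∈p-y (X⊑H .V-⊆ i∈V) λ { refl → y∉V i∈V }
⊑-⁻-outside {H = H} pX y∉V X⊑H .E-⊆ e∈ = edge-⁻⁺ {H = H} (X⊑H .E-⊆ e∈) (y∉V ∘ pX .edge-⊆V e∈)
⊑-⁻-outside pX y∉V X⊑H .M-⊆ i∈M =
  x∈p∧x≢y⇒x∈p-y (X⊑H .M-⊆ i∈M) λ { refl → y∉V (pX .M-⊆V i∈M) }
⊑-⁻-outside pX y∉V X⊑H .M-⊇ i∈V i∈M = X⊑H .M-⊇ i∈V (proj₁ (x∈p-y⁻ i∈M))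

unmarkedSet-⊑ : X ⊑ H → unmarkedSet X ⊆ unmarkedSet H
unmarkedSet-⊑ X⊑H i∈ with x∈p─q⁻ i∈
... | i∈V , i∉M = x∈p∧x∉q⇒x∈p─q (X⊑H .V-⊆ i∈V) (i∉M ∘ X⊑H .M-⊇ i∈V)

unmarkedCount-⊑ : X ⊑ H → unmarkedCount X ≤ unmarkedCount H
unmarkedCount-⊑ = p⊆q⇒∣p∣≤∣q∣ ∘ unmarkedSet-⊑

unmarkedSet-⁺ : unmarkedSet (H ⁺ x) ⊆ unmarkedSet H - x
unmarkedSet-⁺ {x = x} i∈ with x∈p─q⁻ i∈
... | i∈V , i∉M = x∈p∧x≢y⇒x∈p-y (x∈p∧x∉q⇒x∈p─q i∈V (i∉M ∘ x∈p∪q⁺ ∘ inj₁))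
                                 λ { refl → i∉M (x∈p∪q⁺ (inj₂ (x∈⁅x⁆ x))) }

unmarkedSet-⁻ : unmarkedSet (H ⁻ y) ⊆ unmarkedSet H - y
unmarkedSet-⁻ i∈ with x∈p─q⁻ i∈
... | i∈V , i∉M with x∈p-y⁻ i∈V
... | i∈VH , i≢y = x∈p∧x≢y⇒x∈p-y (x∈p∧x∉q⇒x∈p─q i∈VH (i∉M ∘ (λ i∈M → x∈p∧x≢y⇒x∈p-y i∈M i≢y))) i≢y

unmarkedCount-round : x ∈ unmarkedSet H → y ∈ unmarkedSet H → y ≢ x →
                      unmarkedCount H ≤ suc k → unmarkedCount ((H ⁺ x) ⁻ y) ≤ k
unmarkedCount-round {x = x} {H = H} {y = y} x∈ y∈ y≢x count≤1+k =
  ≤-trans (<⇒≤ (≤-<-trans (p⊆q⇒∣p∣≤∣q∣ shrink) (x∈p⇒∣p-x∣<∣p∣ y∈U-x)))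
          (≤-pred (≤-trans (x∈p⇒∣p-x∣<∣p∣ x∈) count≤1+k))
  where
  y∈U-x : y ∈ unmarkedSet H - x
  y∈U-x = x∈p∧x≢y⇒x∈p-y y∈ y≢x
  shrink : unmarkedSet ((H ⁺ x) ⁻ y) ⊆ (unmarkedSet H - x) - y
  shrink = p⊆q⇒p-y⊆q-y (unmarkedSet-⁺ {H = H}) ∘ unmarkedSet-⁻ {H = H ⁺ x}

matchBreakerMove : Proper X → X ⊑ H → 1 < unmarkedCount X →
                   x ∈ unmarkedSet X → y ∈ unmarkedSet H → y ≢ x →
                   ∃ λ y′ → y′ ∈ unmarkedSet X × y′ ≢ x × (X ⁺ x) ⁻ y′ ⊑ (H ⁺ x) ⁻ y
matchBreakerMove {X = X} {y = y} pX X⊑H 1<count x∈ y∈ y≢x with y ∈? V X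
... | yes y∈V = y , x∈p∧x∉q⇒x∈p─q y∈V (proj₂ (x∈p─q⁻ y∈) ∘ X⊑H .M-⊆) , y≢x , ⊑-⁻ (⊑-⁺ X⊑H)
... | no y∉V with 1<∣p∣⇒∃≢ 1<count _
... | y′ , y′∈ , y′≢x =
  y′ , y′∈ , y′≢x , ⊑-trans ⁻-⊑ (⊑-⁻-outside (Proper-⁺ (proj₁ (x∈p─q⁻ x∈)) pX) y∉V (⊑-⁺ X⊑H))

trivialWin-⊑ : X ⊑ H → TrivialWin X → TrivialWin H
trivialWin-⊑ X⊑H (e , e∈ , gap≤1) =
  e , X⊑H .E-⊆ e∈ , ≤-trans (p⊆q⇒∣p∣≤∣q∣ (─-anti e (X⊑H .M-⊆))) gap≤1

minEdgeGap-⊑ : X ⊑ H → minEdgeGap H ≤∞ minEdgeGap X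
minEdgeGap-⊑ {X = X} {H} X⊑H =
  minimum∞-map-≤ (λ e → fin ∣ e ─ M X ∣) (λ e → fin ∣ e ─ M H ∣) (E X) (E H)
    λ {e} e∈ → e , X⊑H .E-⊆ e∈ , fin≤fin (p⊆q⇒∣p∣≤∣q∣ (─-anti e (X⊑H .M-⊆)))

minEdgeGap≤1 : TrivialWin H → minEdgeGap H ≤∞ fin 1
minEdgeGap≤1 {H = H} (e , e∈ , gap≤1) =
  ≤∞-trans (minimum∞≤ (λ e → fin ∣ e ─ M H ∣) e∈) (fin≤fin gap≤1)

edge─M⊆unmarkedSet : ∀ {e} → Proper H → e List.∈ E H → e ─ M H ⊆ unmarkedSet H
edge─M⊆unmarkedSet pH e∈ i∈ with x∈p─q⁻ i∈
... | i∈e , i∉M = x∈p∧x∉q⇒x∈p─q (pH .edge-⊆V e∈ i∈e) i∉M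

-- Maker first claims the (at most one) free vertex x of a winning edge e; afterwards
-- Breaker can never delete e, and e stays within one free vertex of being complete.
trivialWin⇒MakerWinF : Proper H → unmarkedCount H ≤ k → TrivialWin H → MakerWinF k H
trivialWin⇒MakerWinF {H = H} pH count≤k tw with unmarkedCount H ≤? 1
... | yes few = inj₁ (few , tw)
trivialWin⇒MakerWinF {k = zero} pH count≤k tw | no many = contradiction (≤-trans count≤k z≤n) many
trivialWin⇒MakerWinF {H = H} {k = suc k} pH count≤k (e , e∈ , gap≤1) | no many
  with ∣p∣≤1⇒⊆⁅x⁆ (edge─M⊆unmarkedSet pH e∈) gap≤1 (0<∣p∣⇒Nonempty (≤-trans (n≤1+n 1) (≰⇒> many)))
... | x , x∈ , free⊆⁅x⁆ = inj₂ (≰⇒> many , x , x∈V , x∉M , keep)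
  where
  x∈V : x ∈ V H
  x∈V = proj₁ (x∈p─q⁻ x∈)
  x∉M : x ∉ M H
  x∉M = proj₂ (x∈p─q⁻ x∈)
  keep : ∀ y → y ∈ V H → y ∉ M H → y ≢ x → MakerWinF k ((H ⁺ x) ⁻ y)
  keep y y∈V y∉M y≢x =
    trivialWin⇒MakerWinF (Proper-⁻ (Proper-⁺ x∈V pH))
      (unmarkedCount-round {H = H} x∈ (x∈p∧x∉q⇒x∈p─q y∈V y∉M) y≢x count≤k)
      (e , edge-⁻⁺ {H = H ⁺ x} e∈ y∉e , ≤-trans (p⊆q⇒∣p∣≤∣q∣ (─-anti e M⊆)) gap≤1)
    where
    y∉e : y ∉ e
    y∉e y∈e = y≢x (x∈⁅y⁆⇒x≡y x (free⊆⁅x⁆ (x∈p∧x∉q⇒x∈p─q y∈e y∉M)))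
    M⊆ : M H ⊆ M ((H ⁺ x) ⁻ y)
    M⊆ i∈M = x∈p∧x≢y⇒x∈p-y (x∈p∪q⁺ (inj₁ i∈M)) λ { refl → y∉M i∈M }

τF-⊑ : Proper X → X ⊑ H → unmarkedCount X ≤ k → unmarkedCount H ≤ kh → τF kh H ≤∞ τF k X
τF-⊑ {X = X} {H} {k} {kh} pX X⊑H countX countH
  with trivialWin-dec X | unmarkedCount X ≤? 1 | trivialWin-dec H
... | yes twX | _ | _
  rewrite τF-trivial {H = X} {k} twX | τF-trivial {H = H} {kh} (trivialWin-⊑ X⊑H twX) = minEdgeGap-⊑ X⊑H
... | no ¬twX | yes few | _ = subst (τF kh H ≤∞_) (sym (τF-stuck {H = X} {k} ¬twX few)) (_ ≤∞∞)
... | no ¬twX | no many | yes twH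
  rewrite τF-trivial {H = H} {kh} twH = ≤∞-trans (minEdgeGap≤1 {H = H} twH) (1≤τF-nontrivial {H = X} {k} ¬twX)
τF-⊑ {k = zero} _ _ countX _ | no _ | no many | no _ = contradiction (≤-trans countX z≤n) many
τF-⊑ {k = suc _} {kh = zero} _ X⊑H countX countH | no _ | no many | no _ =
  contradiction (≤-trans (unmarkedCount-⊑ X⊑H) (≤-trans countH z≤n)) many
τF-⊑ {X = X} {H} {suc k} {suc kh} pX X⊑H countX countH | no ¬twX | no many | no ¬twH
  rewrite τF-step {H = X} {k} ¬twX (≰⇒> many)
        | τF-step {H = H} {kh} ¬twH (<-≤-trans (≰⇒> many) (unmarkedCount-⊑ X⊑H)) =
  suc∞-mono (minimum∞-map-≤ (replyValue k X) (replyValue kh H) (unmarked X) (unmarked H)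
    λ {x} x∈ → x , ∈-unmarked⁺ {H = H} (unmarkedSet-⊑ X⊑H (∈-unmarked⁻ {H = X} x∈))
                , replyValue-⊑ (∈-unmarked⁻ {H = X} x∈))
  where
  replyValue-⊑ : x ∈ unmarkedSet X → replyValue kh H x ≤∞ replyValue k X x
  replyValue-⊑ {x} x∈ = maximum∞-map-≤ _ _ (others x (unmarked X)) (others x (unmarked H)) reply
    where
    reply : ∀ {y} → y List.∈ others x (unmarked H) →
            ∃ λ y′ → y′ List.∈ others x (unmarked X) × τF kh ((H ⁺ x) ⁻ y) ≤∞ τF k ((X ⁺ x) ⁻ y′)
    reply y∈others with ∈-others⁻ y∈others
    ... | y∈ , y≢x with matchBreakerMove pX X⊑H (≰⇒> many) x∈ (∈-unmarked⁻ {H = H} y∈) y≢x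
    ... | y′ , y′∈ , y′≢x , after⊑ =
      y′ , ∈-others⁺ (∈-unmarked⁺ {H = X} y′∈) y′≢x ,
      τF-⊑ (Proper-⁻ (Proper-⁺ (proj₁ (x∈p─q⁻ x∈)) pX)) after⊑
           (unmarkedCount-round {H = X} x∈ y′∈ y′≢x countX)
           (unmarkedCount-round {H = H} (unmarkedSet-⊑ X⊑H x∈) (∈-unmarked⁻ {H = H} y∈) y≢x countH)

MakerWinF-⊑ : Proper H → Proper X → X ⊑ H → unmarkedCount X ≤ k → unmarkedCount H ≤ kh →
              MakerWinF k X → MakerWinF kh H
MakerWinF-⊑ pH pX X⊑H countX countH (inj₁ (_ , twX)) =
  trivialWin⇒MakerWinF pH countH (trivialWin-⊑ X⊑H twX)
MakerWinF-⊑ {k = zero} pH pX X⊑H countX countH (inj₂ (_ , ()))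
MakerWinF-⊑ {k = suc k} {kh = zero} pH pX X⊑H countX countH (inj₂ (many , _)) =
  contradiction (≤-trans (unmarkedCount-⊑ X⊑H) (≤-trans countH z≤n)) (<⇒≱ many)
MakerWinF-⊑ {H = H} {X = X} {k = suc k} {kh = suc kh} pH pX X⊑H countX countH
  (inj₂ (many , x , x∈V , x∉M , win)) =
  inj₂ (<-≤-trans many (unmarkedCount-⊑ X⊑H) , x , x∈p─q⁻ x∈H .proj₁ , x∈p─q⁻ x∈H .proj₂ , reply)
  where
  x∈ : x ∈ unmarkedSet X
  x∈ = x∈p∧x∉q⇒x∈p─q x∈V x∉M
  x∈H : x ∈ unmarkedSet H
  x∈H = unmarkedSet-⊑ X⊑H x∈
  reply : ∀ y → y ∈ V H → y ∉ M H → y ≢ x → MakerWinF kh ((H ⁺ x) ⁻ y)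
  reply y y∈V y∉M y≢x with matchBreakerMove pX X⊑H many x∈ (x∈p∧x∉q⇒x∈p─q y∈V y∉M) y≢x
  ... | y′ , y′∈ , y′≢x , after⊑ =
    MakerWinF-⊑ (Proper-⁻ (Proper-⁺ (X⊑H .V-⊆ x∈V) pH)) (Proper-⁻ (Proper-⁺ x∈V pX)) after⊑
      (unmarkedCount-round {H = X} x∈ y′∈ y′≢x countX)
      (unmarkedCount-round {H = H} x∈H (x∈p∧x∉q⇒x∈p─q y∈V y∉M) y≢x countH)
      (win y′ (x∈p─q⁻ y′∈ .proj₁) (x∈p─q⁻ y′∈ .proj₂) y′≢x)

mainTheorem12 : ∀ {n : ℕ} (H X : MHyp n) → WellFormed H → WellFormed X → IsSub X H →
    (τM H ≤∞ τM X) × (MakerWin X → MakerWin H)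
mainTheorem12 H X wfH wfX X⊆H =
  τF-⊑ (WellFormed⇒Proper wfX) X⊑H ≤-refl ≤-refl ,
  MakerWinF-⊑ (WellFormed⇒Proper wfH) (WellFormed⇒Proper wfX) X⊑H ≤-refl ≤-refl
  where
  X⊑H : X ⊑ H
  X⊑H = IsSub⇒⊑ X⊆H
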